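{- Let $X$ be an interval space and $a,b\in X$. If the binary relation $\langle[a,b],\cdot,\cdot\rangle$ on $X$ is transitive, then for every $c\in X$, $[\{a\},[b,c]]\subseteq[[a,b],\{c\}]$.
   Context: An interval space is a set $X$ with a ternary relation $\langle\cdot,\cdot,\cdot\rangle$ such that: $\langle x,x,a\rangle$ and $\langle a,x,x\rangle$ for all $a,x\in X$; $\langle x,a,z\rangle\Rightarrow\langle z,a,x\rangle$; and $\langle x,y,x\rangle$ implies $y=x$. For $A\subseteq X$ and $b,c\in X$, $\langle A,b,c\rangle$ means there is $a\in A$ with $\langle a,b,c\rangle$. For $a,c\in X$, $[a,c]=\{x\in X:\langle a,x,c\rangle\}$; for $A,C\subseteq X$, $[A,C]=\{x\in X: \exists a\in A,\,c\in C,\ \langle a,x,c\rangle\}$. -}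

module Defs where

open import Level using (Level; _⊔_; suc)
open import Data.Product using (Σ; _×_; ∃; ∃-syntax)
open import Relation.Binary.PropositionalEquality using (_≡_)
open import Relation.Unary using (Pred; _∈_; _⊆_; ｛_｝)
open import Relation.Binary.Definitions using (Transitive)

record IntervalSpace (ℓ r : Level) : Set (Level.suc (ℓ ⊔ r)) where
  field
    Carrier : Set ℓ
    ⟨_,_,_⟩ : Carrier → Carrier → Carrier → Set r
    left-end  : ∀ a x → ⟨ x , x , a ⟩
    right-end : ∀ a x → ⟨ a , x , x ⟩
    symmetric : ∀ x a z → ⟨ x , a , z ⟩ → ⟨ z , a , x ⟩
    ⟨x,y,x⟩⇒y≡x : ∀ x y → ⟨ x , y , x ⟩ → y ≡ x

  ⟨_∶_,_⟩ : ∀ {p} → Pred Carrier p → Carrier → Carrier → Set (ℓ ⊔ p ⊔ r)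
  ⟨ A ∶ b , c ⟩ = ∃[ a ] (a ∈ A × ⟨ a , b , c ⟩)

  [_,_] : Carrier → Carrier → Pred Carrier r
  [ a , c ] x = ⟨ a , x , c ⟩

  [_⇒_] : ∀ {p q} → Pred Carrier p → Pred Carrier q → Pred Carrier (ℓ ⊔ p ⊔ q ⊔ r)
  [ A ⇒ C ] x = ∃[ a ] ∃[ c ] (a ∈ A × c ∈ C × ⟨ a , x , c ⟩)

module Submission where

-- Proposition 2.2.  Write x ⊑ y for ⟨ [ a , b ] ∶ x , y ⟩, i.e. some
-- p ∈ [a,b] has ⟨ p , x , y ⟩.  Both endpoints lie in [a,b] (by the end
-- axioms of an interval space), so:
--   * ⟨ a , x , y ⟩ gives x ⊑ y, witnessed by the endpoint a, and
--   * ⟨ b , y , c ⟩ gives y ⊑ c, witnessed by the endpoint b.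
-- Hence a point x of [{a},[b,c]], i.e. ⟨ a , x , y ⟩ with ⟨ b , y , c ⟩,
-- satisfies x ⊑ y ⊑ c, so x ⊑ c by transitivity; the witness p ∈ [a,b]
-- with ⟨ p , x , c ⟩ places x in [[a,b],{c}].

open import Defs
open import Level using (Level)
open import Relation.Unary using (Pred; _∈_; _⊆_; ｛_｝)
open import Relation.Binary.Definitions using (Transitive)
open import Relation.Binary.PropositionalEquality using (refl)
open import Data.Product using (_,_)

module IntervalFacts {ℓ r : Level} (X : IntervalSpace ℓ r) where
  open IntervalSpace X

  left-endpoint∈ : ∀ a b → a ∈ [ a , b ]
  left-endpoint∈ a b = left-end b a

  right-endpoint∈ : ∀ a b → b ∈ [ a , b ]
  right-endpoint∈ a b = right-end a b

  witness : ∀ {p} {A : Pred Carrier p} {q x y} → q ∈ A → ⟨ q , x , y ⟩ → ⟨ A ∶ x , y ⟩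
  witness {q = q} q∈A qxy = q , q∈A , qxy

  ∈[A⇒c] : ∀ {p} {A : Pred Carrier p} {x c} → ⟨ A ∶ x , c ⟩ → x ∈ [ A ⇒ ｛ c ｝ ]
  ∈[A⇒c] {c = c} (q , q∈A , qxc) = q , c , q∈A , refl , qxc

proposition2p2 : ∀ {ℓ r : Level} (X : IntervalSpace ℓ r) → let open IntervalSpace X in
    ∀ (a b : Carrier) →
    Transitive (λ x y → ⟨ [ a , b ] ∶ x , y ⟩) →
    ∀ (c : Carrier) → [ ｛ a ｝ ⇒ [ b , c ] ] ⊆ [ [ a , b ] ⇒ ｛ c ｝ ]
proposition2p2 X a b trans c {x} (.a , y , refl , byc , axy) =
  ∈[A⇒c] (trans x⊑y y⊑c)
  where
    open IntervalSpace X
    open IntervalFacts X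
    x⊑y : ⟨ [ a , b ] ∶ x , y ⟩
    x⊑y = witness (left-endpoint∈ a b) axy
    y⊑c : ⟨ [ a , b ] ∶ y , c ⟩
    y⊑c = witness (right-endpoint∈ a b) byc
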